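{- Let $G$ be a graph with no universal vertices or true twins, and let $S$ be the set of vertices of $G$ that belong to some circular pair of $G$. Then $G$ has a circular completion $G'$ with $|V(G')|=2|V(G)|-|S|$.
   Context: Graphs are finite with a loop at every vertex; $N[u]$ is the closed neighbourhood. Universal vertex: $N[u]=V$; true twins: $N[u]=N[v]$. Edge types: $uv$ is an inclusion edge if $N[u],N[v]$ are comparable under inclusion, otherwise an overlap edge; $\{u,v\}$ is a spanning pair if every $x\notin N[v]$ has $N[x]\subseteq N[u]$ and every $y\notin N[u]$ has $N[y]\subseteq N[v]$; an overlap edge is 2-overlap if its endpoints form a spanning pair, 1-overlap otherwise. $\{u,v\}$ is a circular pair if it is a spanning pair and $uv\notin E$. A graph is circularly-paired if every vertex belongs to some circular pair. A circular completion of $G$ is a circularly-paired graph $H$ with the minimum number of vertices such that $H$ contains $G$ as an induced subgraph and every edge of $G$ has the same type in $G$ and in $H$. -}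

module Defs where

open import Data.Nat using (ℕ; _≤_)
open import Data.Bool using (Bool; true; false)
open import Data.Bool.Properties using () renaming (_≟_ to _≟ᵇ_)
open import Data.Fin using (Fin)
open import Data.Fin.Properties using (all?; any?)
open import Data.List using (length; filter)
open import Data.List.Base using ()
open import Data.Fin.Base using ()
open import Data.List using (List)
open import Data.Product using (Σ; Σ-syntax; ∃; _×_; _,_)
open import Data.Sum using (_⊎_)
open import Function using (Injective)
open import Relation.Nullary using (¬_; Dec)
open import Relation.Nullary.Decidable using (_×-dec_; _→-dec_)
open import Relation.Binary.PropositionalEquality using (_≡_)
import Data.List as L
import Data.Fin as F

record Graph (n : ℕ) : Set where
  field
    adj      : Fin n → Fin n → Bool
    adj-refl : ∀ u → adj u u ≡ true
    adj-sym  : ∀ u v → adj u v ≡ adj v u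
open Graph public

module _ {n : ℕ} (G : Graph n) where

  _⊆N_ : Fin n → Fin n → Set
  u ⊆N v = ∀ x → adj G u x ≡ true → adj G v x ≡ true

  Universal : Fin n → Set
  Universal u = ∀ x → adj G u x ≡ true

  TrueTwins : Fin n → Fin n → Set
  TrueTwins u v = ¬ (u ≡ v) × (u ⊆N v) × (v ⊆N u)

  -- uv is an inclusion edge (N[u], N[v] comparable); only meaningful when uv ∈ E
  InclusionEdge : Fin n → Fin n → Set
  InclusionEdge u v = (u ⊆N v) ⊎ (v ⊆N u)

  SpanningPair : Fin n → Fin n → Set
  SpanningPair u v =
    (∀ x → adj G v x ≡ false → x ⊆N u) × (∀ y → adj G u y ≡ false → y ⊆N v)

  TwoOverlapEdge : Fin n → Fin n → Set
  TwoOverlapEdge u v = ¬ InclusionEdge u v × SpanningPair u v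

  OneOverlapEdge : Fin n → Fin n → Set
  OneOverlapEdge u v = ¬ InclusionEdge u v × ¬ SpanningPair u v

  CircularPair : Fin n → Fin n → Set
  CircularPair u v = SpanningPair u v × adj G u v ≡ false

  InCircularPair : Fin n → Set
  InCircularPair u = ∃ λ v → CircularPair u v

  CircularlyPaired : Set
  CircularlyPaired = ∀ u → InCircularPair u

  NoUniversalVertex : Set
  NoUniversalVertex = ∀ u → ¬ Universal u

  NoTrueTwins : Set
  NoTrueTwins = ∀ u v → ¬ TrueTwins u v

  ⊆N? : ∀ u v → Dec (u ⊆N v)
  ⊆N? u v = all? (λ x → (adj G u x ≟ᵇ true) →-dec (adj G v x ≟ᵇ true))

  SpanningPair? : ∀ u v → Dec (SpanningPair u v)
  SpanningPair? u v =
    all? (λ x → (adj G v x ≟ᵇ false) →-dec ⊆N? x u)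
    ×-dec all? (λ y → (adj G u y ≟ᵇ false) →-dec ⊆N? y v)

  InCircularPair? : ∀ u → Dec (InCircularPair u)
  InCircularPair? u = any? (λ v → SpanningPair? u v ×-dec (adj G u v ≟ᵇ false))

  numCircular : ℕ
  numCircular = length (filter InCircularPair? (L.allFin n))

record TypePreservingEmbedding {n m : ℕ} (G : Graph n) (H : Graph m)
       (f : Fin n → Fin m) : Set where
  field
    injective : Injective _≡_ _≡_ f
    induced   : ∀ u v → adj H (f u) (f v) ≡ adj G u v
    incl-pres : ∀ u v → adj G u v ≡ true →
                (InclusionEdge G u v → InclusionEdge H (f u) (f v)) ×
                (InclusionEdge H (f u) (f v) → InclusionEdge G u v)
    one-pres  : ∀ u v → adj G u v ≡ true →
                (OneOverlapEdge G u v → OneOverlapEdge H (f u) (f v)) ×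
                (OneOverlapEdge H (f u) (f v) → OneOverlapEdge G u v)
    two-pres  : ∀ u v → adj G u v ≡ true →
                (TwoOverlapEdge G u v → TwoOverlapEdge H (f u) (f v)) ×
                (TwoOverlapEdge H (f u) (f v) → TwoOverlapEdge G u v)

CompletionCandidate : {n m : ℕ} → Graph n → Graph m → Set
CompletionCandidate G H =
  CircularlyPaired H × Σ[ f ∈ (_ → _) ] TypePreservingEmbedding G H f

CircularCompletion : {n m : ℕ} → Graph n → Graph m → Set
CircularCompletion {n} {m} G H =
  CompletionCandidate G H ×
  (∀ (m′ : ℕ) (H′ : Graph m′) → CompletionCandidate G H′ → m ≤ m′)

-- Every vertex u outside S receives a new partner u′, adjacent to exactly the
-- vertices whose neighbourhood is not contained in N[u]; two partners are
-- adjacent unless their originals form a spanning pair.  This keeps the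
-- neighbourhood order and the spanning pairs of G, so all edge types survive,
-- and makes {u, u′} a circular pair.  Conversely, in any circularly-paired
-- extension the partner of a vertex outside S lies outside G (a partner inside
-- G would be a circular partner in G), and two such vertices with a common
-- partner would have equal neighbourhoods, i.e. be true twins; so at least
-- |V(G) ∖ S| new vertices are needed.
module Submission where

open import Defs
open import Data.Bool using (true; false)
open import Data.Bool.Properties using (¬-not; not-¬) renaming (_≟_ to _≟ᵇ_)
open import Data.Empty using (⊥-elim)
import Data.Fin as Fin
open import Data.Fin using (Fin) renaming (_≟_ to _≟ᶠ_)
open import Data.Fin.Properties using (+↔⊎; injective⇒≤)
open import Data.List using (List; []; _∷_; length; filter; lookup; allFin)
open import Data.List.Properties using (length-tabulate)
open import Data.List.Membership.Propositional.Properties using (∈-filter⁺; ∈-allFin; ∈-lookup)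
import Data.List.Relation.Unary.All as All
open import Data.List.Relation.Unary.All.Properties using (all-filter)
open import Data.List.Relation.Unary.AllPairs using (_∷_)
open import Data.List.Relation.Unary.Any using (index)
open import Data.List.Relation.Unary.Any.Properties using (lookup-index)
open import Data.List.Relation.Unary.Unique.Propositional using (Unique)
open import Data.List.Relation.Unary.Unique.Propositional.Properties using (allFin⁺; filter⁺)
open import Data.Nat using (ℕ; suc; _+_; _*_; _∸_; _≤_)
open import Data.Nat.Properties using (+-suc; m+n∸n≡m)
open import Data.Nat.Tactic.RingSolver using (solve-∀)
open import Data.Product using (Σ-syntax; ∃-syntax; _×_; _,_; proj₁; proj₂; swap)
import Data.Product as Product
open import Data.Sum using (_⊎_; inj₁; inj₂; [_,_]′)
import Data.Sum as Sum
open import Data.Sum.Properties using (inj₁-injective)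
open import Function using (_∘_; id; Injective)
open import Function.Bundles using (_↔_; Inverse; Injection; mk⇔)
open import Function.Properties.Inverse using (↔-sym; Inverse⇒Injection)
open import Relation.Nullary using (¬_; Dec; yes; no; does; ¬?)
open import Relation.Nullary.Decidable using (_⊎-dec_; dec-true; decidable-stable; does-⇔)
open import Relation.Unary using (Decidable)
open import Relation.Binary.PropositionalEquality
  using (_≡_; _≢_; refl; sym; trans; cong; subst; module ≡-Reasoning)

does-true⇒ : ∀ {A : Set} (a? : Dec A) → does a? ≡ true → A
does-true⇒ (yes a) _ = a
does-true⇒ (no _) ()

does-≟-true : ∀ b → does (b ≟ᵇ true) ≡ b
does-≟-true true = refl
does-≟-true false = refl

module _ {n : ℕ} (G : Graph n) where

  ⊆N-refl : ∀ {u} → _⊆N_ G u u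
  ⊆N-refl _ ux = ux

  ⊆N-trans : ∀ {u v w} → _⊆N_ G u v → _⊆N_ G v w → _⊆N_ G u w
  ⊆N-trans u⊆v v⊆w x = v⊆w x ∘ u⊆v x

  ⊆N-nonadj : ∀ {u v x} → _⊆N_ G u v → adj G v x ≡ false → adj G u x ≡ false
  ⊆N-nonadj {x = x} u⊆v vx = ¬-not (not-¬ vx ∘ u⊆v x)

  SpanningPair-mono : ∀ {u v u′ v′} → SpanningPair G u v →
                      _⊆N_ G u u′ → _⊆N_ G v v′ → SpanningPair G u′ v′
  SpanningPair-mono (s₁ , s₂) u⊆u′ v⊆v′ =
    (λ x v′x → ⊆N-trans (s₁ x (⊆N-nonadj v⊆v′ v′x)) u⊆u′) ,
    (λ y u′y → ⊆N-trans (s₂ y (⊆N-nonadj u⊆u′ u′y)) v⊆v′)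

  SpanningPair-refl⇒Universal : ∀ {w} → SpanningPair G w w → Universal G w
  SpanningPair-refl⇒Universal {w} (s , _) x =
    decidable-stable (adj G w x ≟ᵇ true)
      (λ wx≢true → wx≢true (s x (¬-not wx≢true) x (adj-refl G x)))

  NoTrueTwins⇒⊆N-antisym : NoTrueTwins G → ∀ {u v} →
                           _⊆N_ G u v → _⊆N_ G v u → u ≡ v
  NoTrueTwins⇒⊆N-antisym no-twins {u} {v} u⊆v v⊆u =
    decidable-stable (u ≟ᶠ v) (λ u≢v → no-twins u v (u≢v , u⊆v , v⊆u))

common-partner⇒⊆N : ∀ {m} (H : Graph m) {a b z} →
                    CircularPair H a z → CircularPair H b z → _⊆N_ H a b
common-partner⇒⊆N H {a} {z = z} (_ , az) ((s , _) , _) =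
  s a (trans (adj-sym H z a) az)

Induced : ∀ {n m} → Graph n → Graph m → (Fin n → Fin m) → Set
Induced G H f = ∀ u v → adj H (f u) (f v) ≡ adj G u v

module _ {n m : ℕ} (G : Graph n) (H : Graph m) (f : Fin n → Fin m)
         (f-induced : Induced G H f) where

  ⊆N-reflect : ∀ {u v} → _⊆N_ H (f u) (f v) → _⊆N_ G u v
  ⊆N-reflect {u} {v} fu⊆fv x ux =
    trans (sym (f-induced v x)) (fu⊆fv (f x) (trans (f-induced u x) ux))

  SpanningPair-reflect : ∀ {u v} → SpanningPair H (f u) (f v) → SpanningPair G u v
  SpanningPair-reflect {u} {v} (s₁ , s₂) =
    (λ x vx → ⊆N-reflect (s₁ (f x) (trans (f-induced v x) vx))) ,
    (λ y uy → ⊆N-reflect (s₂ (f y) (trans (f-induced u y) uy)))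

  CircularPair-reflect : ∀ {u v} → CircularPair H (f u) (f v) → CircularPair G u v
  CircularPair-reflect {u} {v} (s , fufv) =
    SpanningPair-reflect s , trans (sym (f-induced u v)) fufv

  -- Types are preserved on all pairs.
  typePreserving : Injective _≡_ _≡_ f →
                   (∀ {u v} → _⊆N_ G u v → _⊆N_ H (f u) (f v)) →
                   (∀ {u v} → SpanningPair G u v → SpanningPair H (f u) (f v)) →
                   TypePreservingEmbedding G H f
  typePreserving f-injective ⊆N-preserve SpanningPair-preserve = record
    { injective = f-injective
    ; induced   = f-induced
    ; incl-pres = λ _ _ _ → incl-preserve , incl-reflect
    ; one-pres  = λ _ _ _ →
        Product.map (_∘ incl-reflect) (_∘ SpanningPair-reflect) ,
        Product.map (_∘ incl-preserve) (_∘ SpanningPair-preserve)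
    ; two-pres  = λ _ _ _ →
        Product.map (_∘ incl-reflect) SpanningPair-preserve ,
        Product.map (_∘ incl-preserve) SpanningPair-reflect
    }
    where
    incl-preserve : ∀ {u v} → InclusionEdge G u v → InclusionEdge H (f u) (f v)
    incl-preserve = Sum.map ⊆N-preserve ⊆N-preserve

    incl-reflect : ∀ {u v} → InclusionEdge H (f u) (f v) → InclusionEdge G u v
    incl-reflect = Sum.map ⊆N-reflect ⊆N-reflect

module _ {n k m : ℕ} (G : Graph n) (H : Graph m) (no-twins : NoTrueTwins G)
         (e : Fin k → Fin n) (e-injective : Injective _≡_ _≡_ e)
         (e-unpaired : ∀ i → ¬ InCircularPair G (e i))
         (H-paired : CircularlyPaired H)
         {g : Fin n → Fin m} (g-injective : Injective _≡_ _≡_ g) (g-induced : Induced G H g)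
         where

  private
    partner : Fin k → Fin m
    partner i = proj₁ (H-paired (g (e i)))

    partner-circular : ∀ i → CircularPair H (g (e i)) (partner i)
    partner-circular i = proj₂ (H-paired (g (e i)))

    partner≢g : ∀ i u → partner i ≢ g u
    partner≢g i u eq = e-unpaired i (u , CircularPair-reflect G H g g-induced
      (subst (CircularPair H (g (e i))) eq (partner-circular i)))

    partner-injective : Injective _≡_ _≡_ partner
    partner-injective {i} {j} eq = e-injective (NoTrueTwins⇒⊆N-antisym G no-twins
      (⊆N-reflect G H g g-induced (common-partner⇒⊆N H pᵢ pⱼ))
      (⊆N-reflect G H g g-induced (common-partner⇒⊆N H pⱼ pᵢ)))
      where
      pᵢ = partner-circular i
      pⱼ = subst (CircularPair H (g (e j))) (sym eq) (partner-circular j)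

    embed : Fin n ⊎ Fin k → Fin m
    embed = [ g , partner ]′

    embed-injective : Injective _≡_ _≡_ embed
    embed-injective {inj₁ u} {inj₁ v} eq = cong inj₁ (g-injective eq)
    embed-injective {inj₁ u} {inj₂ j} eq = ⊥-elim (partner≢g j u (sym eq))
    embed-injective {inj₂ i} {inj₁ v} eq = ⊥-elim (partner≢g i v eq)
    embed-injective {inj₂ i} {inj₂ j} eq = cong inj₂ (partner-injective eq)

  extension-size-lower-bound : n + k ≤ m
  extension-size-lower-bound = injective⇒≤ {f = embed ∘ Inverse.to +↔⊎}
    (Injection.injective (Inverse⇒Injection +↔⊎) ∘ embed-injective)

module FromRelation {A : Set} {m : ℕ} (ι : Fin m ↔ A)
                    (R : A → A → Set) (R? : ∀ a b → Dec (R a b))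
                    (R-refl : ∀ a → R a a) (R-sym : ∀ a b → R a b → R b a) where

  open Inverse ι using (to; from; strictlyInverseˡ; strictlyInverseʳ)

  graph : Graph m
  graph = record
    { adj      = λ x y → does (R? (to x) (to y))
    ; adj-refl = λ x → dec-true (R? (to x) (to x)) (R-refl (to x))
    ; adj-sym  = λ x y →
        does-⇔ (mk⇔ (R-sym (to x) (to y)) (R-sym (to y) (to x))) (R? _ _) (R? _ _)
    }

  _⊆ᴿ_ : A → A → Set
  a ⊆ᴿ b = ∀ c → R a c → R b c

  SpanningPairᴿ : A → A → Set
  SpanningPairᴿ a b = (∀ c → ¬ R b c → c ⊆ᴿ a) × (∀ c → ¬ R a c → c ⊆ᴿ b)

  adj-from : ∀ a b → adj graph (from a) (from b) ≡ does (R? a b)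
  adj-from a b rewrite strictlyInverseˡ a | strictlyInverseˡ b = refl

  private
    every-vertex : {P : Fin m → Set} → (∀ a → P (from a)) → ∀ x → P x
    every-vertex {P} p x = subst P (strictlyInverseʳ x) (p (to x))

    R⇒adj : ∀ {a b} → R a b → adj graph (from a) (from b) ≡ true
    R⇒adj {a} {b} r = trans (adj-from a b) (dec-true (R? a b) r)

    adj⇒R : ∀ {a b} → adj graph (from a) (from b) ≡ true → R a b
    adj⇒R {a} {b} ab = does-true⇒ (R? a b) (trans (sym (adj-from a b)) ab)

    ¬R⇒nonadj : ∀ {a b} → ¬ R a b → adj graph (from a) (from b) ≡ false
    ¬R⇒nonadj ¬r = ¬-not (¬r ∘ adj⇒R)

    nonadj⇒¬R : ∀ {a b} → adj graph (from a) (from b) ≡ false → ¬ R a b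
    nonadj⇒¬R ab = not-¬ ab ∘ R⇒adj

  ⊆ᴿ⇒⊆N : ∀ {a b} → a ⊆ᴿ b → _⊆N_ graph (from a) (from b)
  ⊆ᴿ⇒⊆N a⊆b = every-vertex (λ c → R⇒adj ∘ a⊆b c ∘ adj⇒R)

  SpanningPairᴿ⇒SpanningPair : ∀ {a b} → SpanningPairᴿ a b →
                               SpanningPair graph (from a) (from b)
  SpanningPairᴿ⇒SpanningPair (s₁ , s₂) =
    every-vertex (λ c → ⊆ᴿ⇒⊆N ∘ s₁ c ∘ nonadj⇒¬R) ,
    every-vertex (λ c → ⊆ᴿ⇒⊆N ∘ s₂ c ∘ nonadj⇒¬R)

  circularlyPaired : (∀ a → ∃[ b ] SpanningPairᴿ a b × ¬ R a b) →
                     CircularlyPaired graph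
  circularlyPaired pair = every-vertex λ a →
    let (b , s , ¬r) = pair a in
    from b , SpanningPairᴿ⇒SpanningPair s , ¬R⇒nonadj ¬r

-- inj₁ u is the vertex u of G and inj₂ i the new partner of e i.
module Completion {n k : ℕ} (G : Graph n) (no-universal : NoUniversalVertex G)
                  (e : Fin k → Fin n) where

  Vertex : Set
  Vertex = Fin n ⊎ Fin k

  _~_ : Vertex → Vertex → Set
  inj₁ x ~ inj₁ y = adj G x y ≡ true
  inj₁ x ~ inj₂ j = ¬ _⊆N_ G x (e j)
  inj₂ i ~ inj₁ y = ¬ _⊆N_ G y (e i)
  inj₂ i ~ inj₂ j = i ≡ j ⊎ ¬ SpanningPair G (e i) (e j)

  _~?_ : ∀ a b → Dec (a ~ b)
  inj₁ x ~? inj₁ y = adj G x y ≟ᵇ true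
  inj₁ x ~? inj₂ j = ¬? (⊆N? G x (e j))
  inj₂ i ~? inj₁ y = ¬? (⊆N? G y (e i))
  inj₂ i ~? inj₂ j = (i ≟ᶠ j) ⊎-dec ¬? (SpanningPair? G (e i) (e j))

  ~-refl : ∀ a → a ~ a
  ~-refl (inj₁ x) = adj-refl G x
  ~-refl (inj₂ i) = inj₁ refl

  ~-sym : ∀ a b → a ~ b → b ~ a
  ~-sym (inj₁ x) (inj₁ y) xy = trans (adj-sym G y x) xy
  ~-sym (inj₁ x) (inj₂ j) xj = xj
  ~-sym (inj₂ i) (inj₁ y) iy = iy
  ~-sym (inj₂ i) (inj₂ j) ij = Sum.map sym (_∘ swap) ij

  open FromRelation +↔⊎ _~_ _~?_ ~-refl ~-sym public

  ¬SpanningPair-refl : ∀ {w} → ¬ SpanningPair G w w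
  ¬SpanningPair-refl = no-universal _ ∘ SpanningPair-refl⇒Universal G

  partners-adjacent⇒¬SpanningPair : ∀ {i j} → inj₂ i ~ inj₂ j →
                                    ¬ SpanningPair G (e i) (e j)
  partners-adjacent⇒¬SpanningPair = [ (λ { refl → ¬SpanningPair-refl }) , id ]′

  ⊆N⇒⊆ᴿ : ∀ {a b} → _⊆N_ G a b → inj₁ a ⊆ᴿ inj₁ b
  ⊆N⇒⊆ᴿ a⊆b (inj₁ y) ay = a⊆b y ay
  ⊆N⇒⊆ᴿ a⊆b (inj₂ j) a⊈j = a⊈j ∘ ⊆N-trans G a⊆b

  partner-⊆ᴿ : ∀ {a b w} → SpanningPair G a b → _⊆N_ G b (e w) → inj₂ w ⊆ᴿ inj₁ a
  partner-⊆ᴿ {a} s b⊆w (inj₁ z) z⊈w =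
    decidable-stable (adj G a z ≟ᵇ true)
      (λ ¬az → z⊈w (⊆N-trans G (proj₂ s z (¬-not ¬az)) b⊆w))
  partner-⊆ᴿ s b⊆w (inj₂ z) wz a⊆z =
    partners-adjacent⇒¬SpanningPair wz (SpanningPair-mono G (swap s) b⊆w a⊆z)

  SpanningPair⇒SpanningPairᴿ : ∀ {a b} → SpanningPair G a b →
                               SpanningPairᴿ (inj₁ a) (inj₁ b)
  SpanningPair⇒SpanningPairᴿ s = half s , half (swap s)
    where
    half : ∀ {a b} → SpanningPair G a b → ∀ c → ¬ inj₁ b ~ c → c ⊆ᴿ inj₁ a
    half s (inj₁ x) ¬bx = ⊆N⇒⊆ᴿ (proj₁ s x (¬-not ¬bx))
    half {b = b} s (inj₂ w) ¬bw = partner-⊆ᴿ s (decidable-stable (⊆N? G b (e w)) ¬bw)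

  partner-SpanningPairᴿ : ∀ i → SpanningPairᴿ (inj₁ (e i)) (inj₂ i)
  partner-SpanningPairᴿ i = below-original , below-partner
    where
    below-original : ∀ c → ¬ inj₂ i ~ c → c ⊆ᴿ inj₁ (e i)
    below-original (inj₁ x) ¬ix = ⊆N⇒⊆ᴿ (decidable-stable (⊆N? G x (e i)) ¬ix)
    below-original (inj₂ w) ¬iw =
      partner-⊆ᴿ (decidable-stable (SpanningPair? G (e i) (e w)) (¬iw ∘ inj₂)) (⊆N-refl G)

    below-partner : ∀ c → ¬ inj₁ (e i) ~ c → c ⊆ᴿ inj₂ i
    below-partner (inj₁ y) ¬iy (inj₁ z) yz z⊆i = ¬iy (z⊆i y (trans (adj-sym G z y) yz))
    below-partner (inj₁ y) ¬iy (inj₂ w) y⊈w =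
      inj₂ (λ s → y⊈w (proj₂ s y (¬-not ¬iy)))
    below-partner (inj₂ w) ¬iw = λ
      { (inj₁ z) z⊈w z⊆i → z⊈w (⊆N-trans G z⊆i i⊆w)
      ; (inj₂ z) wz → inj₂ (partners-adjacent⇒¬SpanningPair wz
                             ∘ λ s → SpanningPair-mono G s i⊆w (⊆N-refl G))
      }
      where
      i⊆w : _⊆N_ G (e i) (e w)
      i⊆w = decidable-stable (⊆N? G (e i) (e w)) ¬iw

  completion : Graph (n + k)
  completion = graph

  completion-paired : (∀ u → ¬ InCircularPair G u → ∃[ i ] e i ≡ u) →
                      CircularlyPaired completion
  completion-paired covers = circularlyPaired pair
    where
    not-adjacent-to-partner : ∀ i → ¬ inj₁ (e i) ~ inj₂ i
    not-adjacent-to-partner i i⊈i = i⊈i (⊆N-refl G)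

    pair : ∀ a → ∃[ b ] SpanningPairᴿ a b × ¬ a ~ b
    pair (inj₂ i) = inj₁ (e i) , swap (partner-SpanningPairᴿ i) , not-adjacent-to-partner i
    pair (inj₁ u) with InCircularPair? G u
    ... | yes (v , s , uv) = inj₁ v , SpanningPair⇒SpanningPairᴿ s , not-¬ uv
    ... | no u-unpaired with covers u u-unpaired
    ...   | i , refl = inj₂ i , partner-SpanningPairᴿ i , not-adjacent-to-partner i

  original : Fin n → Fin (n + k)
  original u = Inverse.from +↔⊎ (inj₁ u)

  original-typePreserving : TypePreservingEmbedding G completion original
  original-typePreserving =
    typePreserving G completion original induced (inj₁-injective ∘ Injection.injective (Inverse⇒Injection (↔-sym +↔⊎)))
      (⊆ᴿ⇒⊆N ∘ ⊆N⇒⊆ᴿ) (SpanningPairᴿ⇒SpanningPair ∘ SpanningPair⇒SpanningPairᴿ)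
    where
    induced : Induced G completion original
    induced u v = trans (adj-from (inj₁ u) (inj₁ v)) (does-≟-true (adj G u v))

lookup-injective : ∀ {A : Set} {xs : List A} → Unique xs → Injective _≡_ _≡_ (lookup xs)
lookup-injective (_ ∷ _) {Fin.zero} {Fin.zero} _ = refl
lookup-injective (x∉xs ∷ _) {Fin.zero} {Fin.suc j} eq = ⊥-elim (All.lookup x∉xs (∈-lookup j) eq)
lookup-injective (x∉xs ∷ _) {Fin.suc i} {Fin.zero} eq =
  ⊥-elim (All.lookup x∉xs (∈-lookup i) (sym eq))
lookup-injective (_ ∷ unique) {Fin.suc i} {Fin.suc j} eq =
  cong Fin.suc (lookup-injective unique eq)

length-filter+length-filter-¬ : ∀ {A : Set} {P : A → Set} (P? : Decidable P) xs →
  length (filter P? xs) + length (filter (¬? ∘ P?) xs) ≡ length xs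
length-filter+length-filter-¬ P? [] = refl
length-filter+length-filter-¬ P? (x ∷ xs) with P? x
... | yes _ = cong suc (length-filter+length-filter-¬ P? xs)
... | no _ = trans (+-suc _ _) (cong suc (length-filter+length-filter-¬ P? xs))

+≡⇒+≡2*∸ : ∀ {s k n} → s + k ≡ n → n + k ≡ 2 * n ∸ s
+≡⇒+≡2*∸ {s} {k} refl = sym (begin
  2 * (s + k) ∸ s    ≡⟨ cong (_∸ s) (double s k) ⟩
  s + k + k + s ∸ s  ≡⟨ m+n∸n≡m (s + k + k) s ⟩
  s + k + k          ∎)
  where
  open ≡-Reasoning
  double : ∀ s k → 2 * (s + k) ≡ s + k + k + s
  double = solve-∀

module Unpaired {n : ℕ} (G : Graph n) where

  vertices : List (Fin n)
  vertices = filter (¬? ∘ InCircularPair? G) (allFin n)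

  count : ℕ
  count = length vertices

  vertex : Fin count → Fin n
  vertex = lookup vertices

  vertex-injective : Injective _≡_ _≡_ vertex
  vertex-injective = lookup-injective (filter⁺ (¬? ∘ InCircularPair? G) (allFin⁺ n))

  vertex-unpaired : ∀ i → ¬ InCircularPair G (vertex i)
  vertex-unpaired i = All.lookup (all-filter (¬? ∘ InCircularPair? G) (allFin n)) (∈-lookup i)

  vertex-covers : ∀ u → ¬ InCircularPair G u → ∃[ i ] vertex i ≡ u
  vertex-covers u u-unpaired = index u∈vertices , sym (lookup-index u∈vertices)
    where
    u∈vertices = ∈-filter⁺ (¬? ∘ InCircularPair? G) (∈-allFin u) u-unpaired

  numCircular+count : numCircular G + count ≡ n
  numCircular+count =
    trans (length-filter+length-filter-¬ (InCircularPair? G) (allFin n)) (length-tabulate id)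

lemma13 : ∀ {n : ℕ} (G : Graph n) → NoUniversalVertex G → NoTrueTwins G →
    Σ[ G′ ∈ Graph (2 * n ∸ numCircular G) ] CircularCompletion G G′
lemma13 {n} G no-universal no-twins =
  subst (λ m → Σ[ G′ ∈ Graph m ] CircularCompletion G G′) (+≡⇒+≡2*∸ numCircular+count)
    (completion , (completion-paired vertex-covers , original , original-typePreserving) , minimal)
  where
  open Unpaired G
  open Completion G no-universal vertex
  open TypePreservingEmbedding

  minimal : ∀ m′ (H′ : Graph m′) → CompletionCandidate G H′ → n + count ≤ m′
  minimal _ H′ (H′-paired , _ , g-embedding) =
    extension-size-lower-bound G H′ no-twins vertex vertex-injective vertex-unpaired H′-paired
      (injective g-embedding) (induced g-embedding)
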